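{- Let $G=(V,E)$ be a connected finite undirected graph with a fixed total order on $V$, and $R=[p]$ with $p\le|V|$. Let $S_1,S_2$ be configurations with $S_1(R)=S_2(R)$, and let $\pi:R\to R$ be the permutation with $S_1(i)=S_2(\pi(i))$ for all $i\in R$. Let $S_1'$ and $S_2'$ be the outputs of the accumulation procedure described below run on $G$ with $S_1$ and with $S_2$, respectively. Then $S_1'(i)=S_2'(\pi(i))$ for all $i\in R$.
   Context: A configuration is an injective map $S:R\to V$. For a simple path $P=(u_0,\dots,u_k)$ with $u_k\notin S(R)$, pushing $S$ along $P$ yields the configuration $S'$ with $S'(i)=u_{j+1}$ if $S(i)=u_j$ ($0\le j\le k-1$) and $S'(i)=S(i)$ otherwise. Accumulation procedure: let $v_1,\dots,v_n$ be the order in which breadth-first search, started at the least vertex and exploring neighbours in increasing order, visits $V$, let $\mathfrak T$ be the resulting BFS tree, and $V_p=\{v_1,\dots,v_p\}$. While $S(R)\neq V_p$: let $a$ be the least $i\in[p]$ with $v_i\notin S(R)$, let $b$ be the least $i\in\{p+1,\dots,n\}$ with $v_i\in S(R)$, let $P$ be the unique path in $\mathfrak T$ from $v_b$ to $v_a$, and replace $S$ by the configuration obtained by pushing $S$ along $P$. Output the final $S$. -}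

module Defs where

open import Data.Nat using (ℕ; zero; suc)
open import Data.Fin using (Fin; zero; suc; _≟_)
open import Data.Bool using (Bool; true; false; if_then_else_; _∧_; _∨_; not)
open import Data.List using (List; []; _∷_; _++_; [_]; take; drop; reverse; allFin;
  filterᵇ; takeWhileᵇ; dropWhileᵇ; findᵇ)
open import Data.List.Membership.Propositional using (_∈_)
open import Data.Bool.ListAction using (any)
open import Data.Maybe using (Maybe; just; nothing; fromMaybe)
open import Data.Product using (∃)
open import Function.Bundles using (_⇔_)
open import Relation.Nullary using (¬_)
open import Relation.Nullary.Decidable using (⌊_⌋)
open import Relation.Binary.PropositionalEquality using (_≡_)

-- Vertex set V = Fin n, totally ordered by the usual order on Fin n.
-- A finite undirected graph is given by a Boolean adjacency function
-- (symmetry is assumed as a hypothesis in the statement).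

eqb : ∀ {n} → Fin n → Fin n → Bool
eqb u v = ⌊ u ≟ v ⌋

memb : ∀ {n} → Fin n → List (Fin n) → Bool
memb v []       = false
memb v (u ∷ us) = eqb u v ∨ memb v us

data Reach {n} (adj : Fin n → Fin n → Bool) : Fin n → Fin n → Set where
  here : ∀ {u} → Reach adj u u
  step : ∀ {u w v} → adj u w ≡ true → Reach adj w v → Reach adj u v

Connected : ∀ {n} → (Fin n → Fin n → Bool) → Set
Connected {n} adj = ∀ (u v : Fin n) → Reach adj u v

-- Breadth-first search from the least vertex (zero), exploring
-- neighbours in increasing order.  State: visiting order, queue,
-- parent function (the BFS tree; the root is its own parent).

record BFSState (n : ℕ) : Set where
  constructor st
  field
    order  : List (Fin n)
    queue  : List (Fin n)
    parent : Fin n → Fin n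

bfsStep : ∀ {n} → (Fin n → Fin n → Bool) → BFSState n → BFSState n
bfsStep adj (st ord [] par) = st ord [] par
bfsStep {n} adj (st ord (u ∷ q) par) = st (ord ++ new) (q ++ new) par'
  where
  new : List (Fin n)
  new = filterᵇ (λ w → adj u w ∧ not (memb w ord)) (allFin n)
  par' : Fin n → Fin n
  par' w = if memb w new then u else par w

bfsIter : ∀ {n} → (Fin n → Fin n → Bool) → ℕ → BFSState n → BFSState n
bfsIter adj zero    s = s
bfsIter adj (suc k) s = bfsIter adj k (bfsStep adj s)

-- n dequeue steps suffice, since every vertex is enqueued at most once.
bfs : ∀ {m} → (Fin (suc m) → Fin (suc m) → Bool) → BFSState (suc m)
bfs {m} adj = bfsIter adj (suc m) (st [ zero ] [ zero ] (λ _ → zero))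

bfsOrder : ∀ {m} → (Fin (suc m) → Fin (suc m) → Bool) → List (Fin (suc m))
bfsOrder adj = BFSState.order (bfs adj)

bfsParent : ∀ {m} → (Fin (suc m) → Fin (suc m) → Bool) → Fin (suc m) → Fin (suc m)
bfsParent adj = BFSState.parent (bfs adj)

ancestors : ∀ {m} → (Fin (suc m) → Fin (suc m)) → ℕ → Fin (suc m) → List (Fin (suc m))
ancestors par zero    x = [ x ]
ancestors par (suc k) x = if eqb x zero then [ x ] else x ∷ ancestors par k (par x)

treePath : ∀ {m} → (Fin (suc m) → Fin (suc m)) → Fin (suc m) → Fin (suc m) → List (Fin (suc m))
treePath {m} par x y = upX ++ take 1 (dropWhileᵇ (λ z → not (memb z ay)) ax) ++ reverse downY
  where
  ax = ancestors par (suc m) x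
  ay = ancestors par (suc m) y
  upX   = takeWhileᵇ (λ z → not (memb z ay)) ax
  downY = takeWhileᵇ (λ z → not (memb z ax)) ay

next : ∀ {n} → List (Fin n) → Fin n → Maybe (Fin n)
next []           v = nothing
next (u ∷ [])     v = nothing
next (u ∷ w ∷ us) v = if eqb u v then just w else next (w ∷ us) v

push : ∀ {n p} → (Fin p → Fin n) → List (Fin n) → (Fin p → Fin n)
push S P i = fromMaybe (S i) (next P (S i))

occupied : ∀ {n p} → (Fin p → Fin n) → Fin n → Bool
occupied {p = p} S v = any (λ i → eqb (S i) v) (allFin p)

ImageIsVp : ∀ {m p} → (Fin (suc m) → Fin (suc m) → Bool) → (Fin p → Fin (suc m)) → Set
ImageIsVp {p = p} adj S = ∀ v → (∃ λ i → S i ≡ v) ⇔ (v ∈ take p (bfsOrder adj))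

-- AccOut adj S S' : the accumulation procedure run on S outputs S'
-- (the loop, written as an inductive relation; it is deterministic).
data AccOut {m p} (adj : Fin (suc m) → Fin (suc m) → Bool)
     : (Fin p → Fin (suc m)) → (Fin p → Fin (suc m)) → Set where
  done : ∀ {S} → ImageIsVp adj S → AccOut adj S S
  loop : ∀ {S S' va vb} → ¬ ImageIsVp adj S
       → findᵇ (λ v → not (occupied S v)) (take p (bfsOrder adj)) ≡ just va
       → findᵇ (λ v → occupied S v) (drop p (bfsOrder adj)) ≡ just vb
       → AccOut adj (push S (treePath (bfsParent adj) vb va)) S'
       → AccOut adj S S'

{-# OPTIONS --safe #-}
module Submission where

-- The accumulation procedure is deterministic and looks at a configuration S
-- only through its image S(R): the test S(R) = V_p and the choice of a and b
-- depend on S(R) alone, and the chosen path P is then the same for S₁ and S₂.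
-- Pushing acts on each i ∈ R separately, so pushing S₂ ∘ π along P is pushing
-- S₂ along P and then relabelling by π; the relation S₁ = S₂ ∘ π is therefore
-- preserved step by step, and both runs stop at the same time.

open import Defs
open import Data.Nat using (ℕ; suc; _≤_)
open import Data.Fin using (Fin)
open import Data.Fin.Permutation using (Permutation′; _⟨$⟩ʳ_; _⟨$⟩ˡ_; inverseʳ)
open import Data.Bool using (Bool; T; not)
open import Data.Bool.Properties using (T-≡; ⇔→≡)
open import Data.List using ([]; _∷_; allFin; findᵇ; take; drop)
open import Data.List.Membership.Propositional using (lose)
open import Data.List.Membership.Propositional.Properties using (∈-allFin)
open import Data.List.Relation.Unary.Any using (satisfied)
open import Data.List.Relation.Unary.Any.Properties using (any⁺; any⁻)
open import Data.Maybe using (just; fromMaybe)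
open import Data.Maybe.Properties using (just-injective)
open import Data.Product using (∃; _,_; map₂)
open import Data.Empty using (⊥-elim)
open import Function.Bundles using (_⇔_; mk⇔; Equivalence)
open import Function.Construct.Composition using (_⇔-∘_)
open import Function.Construct.Symmetry using (⇔-sym)
open import Function.Definitions using (Injective)
open import Relation.Nullary.Decidable using (toWitness; fromWitness)
open import Relation.Binary.PropositionalEquality using (_≡_; refl; sym; trans; cong)

Image : ∀ {n p} → (Fin p → Fin n) → Fin n → Set
Image S v = ∃ λ i → S i ≡ v

SameImage : ∀ {n p} → (Fin p → Fin n) → (Fin p → Fin n) → Set
SameImage S₁ S₂ = ∀ v → Image S₁ v ⇔ Image S₂ v

T-occupied⇔Image : ∀ {n p} (S : Fin p → Fin n) v → T (occupied S v) ⇔ Image S v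
T-occupied⇔Image {p = p} S v = mk⇔
  (λ occ → map₂ toWitness (satisfied (any⁻ _ (allFin p) occ)))
  (λ (i , Si≡v) → any⁺ _ (lose (∈-allFin i) (fromWitness Si≡v)))

occupied-cong : ∀ {n p} {S₁ S₂ : Fin p → Fin n} → SameImage S₁ S₂ →
                ∀ v → occupied S₁ v ≡ occupied S₂ v
occupied-cong {S₁ = S₁} {S₂} same v = ⇔→≡ (T-≡ ⇔-∘ (T-occupied⇔T-occupied ⇔-∘ ⇔-sym T-≡))
  where
  T-occupied⇔T-occupied : T (occupied S₁ v) ⇔ T (occupied S₂ v)
  T-occupied⇔T-occupied =
    ⇔-sym (T-occupied⇔Image S₂ v) ⇔-∘ (same v ⇔-∘ T-occupied⇔Image S₁ v)

ImageIsVp-cong : ∀ {m p} (adj : Fin (suc m) → Fin (suc m) → Bool)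
                 {S₁ S₂ : Fin p → Fin (suc m)} →
                 SameImage S₁ S₂ → ImageIsVp adj S₁ ⇔ ImageIsVp adj S₂
ImageIsVp-cong adj same = mk⇔
  (λ h v → h v ⇔-∘ ⇔-sym (same v))
  (λ h v → h v ⇔-∘ same v)

findᵇ-cong : ∀ {A : Set} {P Q : A → Bool} → (∀ x → P x ≡ Q x) →
             ∀ xs → findᵇ P xs ≡ findᵇ Q xs
findᵇ-cong P≗Q []       = refl
findᵇ-cong P≗Q (x ∷ xs) rewrite P≗Q x | findᵇ-cong P≗Q xs = refl

findᵇ-just-cong : ∀ {A : Set} {P Q : A → Bool} → (∀ x → P x ≡ Q x) →
                  ∀ xs {a b} → findᵇ P xs ≡ just a → findᵇ Q xs ≡ just b → a ≡ b
findᵇ-just-cong P≗Q xs Pa Qb =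
  just-injective (trans (sym Pa) (trans (findᵇ-cong P≗Q xs) Qb))

push-relabel : ∀ {n p q} {S₁ : Fin p → Fin n} {S₂ : Fin q → Fin n} {σ : Fin p → Fin q} →
               (∀ i → S₁ i ≡ S₂ (σ i)) →
               ∀ P i → push S₁ P i ≡ push S₂ P (σ i)
push-relabel S₁≗S₂∘σ P i = cong (λ u → fromMaybe u (next P u)) (S₁≗S₂∘σ i)

relabel-sameImage : ∀ {n p} {S₁ S₂ : Fin p → Fin n} (π : Permutation′ p) →
                    (∀ i → S₁ i ≡ S₂ (π ⟨$⟩ʳ i)) → SameImage S₁ S₂
relabel-sameImage {S₂ = S₂} π S₁≗S₂∘π v = mk⇔
  (λ (i , S₁i≡v) → π ⟨$⟩ʳ i , trans (sym (S₁≗S₂∘π i)) S₁i≡v)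
  (λ (j , S₂j≡v) → π ⟨$⟩ˡ j , trans (S₁≗S₂∘π _) (trans (cong S₂ (inverseʳ π)) S₂j≡v))

AccOut-relabel : ∀ {m p} {adj : Fin (suc m) → Fin (suc m) → Bool} (π : Permutation′ p)
                 {S₁ S₂ S₁′ S₂′ : Fin p → Fin (suc m)} →
                 (∀ i → S₁ i ≡ S₂ (π ⟨$⟩ʳ i)) →
                 AccOut adj S₁ S₁′ → AccOut adj S₂ S₂′ →
                 ∀ i → S₁′ i ≡ S₂′ (π ⟨$⟩ʳ i)
AccOut-relabel π S₁≗S₂∘π (done _) (done _) = S₁≗S₂∘π
AccOut-relabel {adj = adj} π S₁≗S₂∘π (done atVp₁) (loop ¬atVp₂ _ _ _) =
  ⊥-elim (¬atVp₂ (Equivalence.to (ImageIsVp-cong adj (relabel-sameImage π S₁≗S₂∘π)) atVp₁))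
AccOut-relabel {adj = adj} π S₁≗S₂∘π (loop ¬atVp₁ _ _ _) (done atVp₂) =
  ⊥-elim (¬atVp₁ (Equivalence.from (ImageIsVp-cong adj (relabel-sameImage π S₁≗S₂∘π)) atVp₂))
AccOut-relabel {p = p} {adj} π {S₂ = S₂} S₁≗S₂∘π
               (loop {va = a} {b} _ a-first₁ b-first₁ run₁) (loop _ a-first₂ b-first₂ run₂)
  with same ← relabel-sameImage π S₁≗S₂∘π
  with refl ← findᵇ-just-cong (λ v → cong not (occupied-cong same v))
                (take p (bfsOrder adj)) a-first₁ a-first₂
     | refl ← findᵇ-just-cong (occupied-cong same) (drop p (bfsOrder adj)) b-first₁ b-first₂
  = AccOut-relabel π (push-relabel {S₂ = S₂} {σ = π ⟨$⟩ʳ_} S₁≗S₂∘π (treePath (bfsParent adj) b a))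
                   run₁ run₂

lemma7 : (m : ℕ) (adj : Fin (suc m) → Fin (suc m) → Bool)
    → (∀ u v → adj u v ≡ adj v u) → Connected adj
    → (p : ℕ) → p ≤ suc m
    → (S₁ S₂ : Fin p → Fin (suc m))
    → Injective _≡_ _≡_ S₁ → Injective _≡_ _≡_ S₂
    → (∀ v → (∃ λ i → S₁ i ≡ v) ⇔ (∃ λ i → S₂ i ≡ v))
    → (π : Permutation′ p) → (∀ i → S₁ i ≡ S₂ (π ⟨$⟩ʳ i))
    → (S₁′ S₂′ : Fin p → Fin (suc m))
    → AccOut adj S₁ S₁′ → AccOut adj S₂ S₂′
    → ∀ i → S₁′ i ≡ S₂′ (π ⟨$⟩ʳ i)
lemma7 m adj _ _ p _ S₁ S₂ _ _ _ π S₁≗S₂∘π S₁′ S₂′ = AccOut-relabel π S₁≗S₂∘π
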